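{- If a labelled sequent $S$ is derivable in $\mathbf{GA_l}$, then $\models_{\mathbf{A}} S$.
   Context: Formulas are built from propositional variables and $t$ using $+,\to,\Rightarrow$ (binary) and $\lnot$; under a valuation $v$ into $\mathbb{Q}$: $v(t)=0$, $v(A+B)=v(A)+v(B)$, $v(\lnot A)=-v(A)$, $v(A\to B)=v(B)-v(A)$, $v(A\Rightarrow B)=\min(0,v(B)-v(A))$ (i.e. $A\Rightarrow B=(A\to B)\land t$). Labels are generated from the unit label $1$ and atomic labels $x_1,x_2,\ldots$ by concatenation $xy$. A labelled formula is $x:A$ with $x$ a label; a labelled sequent $\Gamma\vdash\Delta$ is a pair of finite multisets of labelled formulas. A labelling function $f$ maps labels to $\{0,1\}$ with $f(1)=1$ and $f(xy)=f(x)f(y)$; $f(\Gamma)$ is the multiset $\{A : x:A\in\Gamma, f(x)=1\}$. $\models_{\mathbf{A}}\Gamma\vdash\Delta$ means: for every valuation $v$ into $\mathbb{Q}$ there is a labelling function $f$ with $\sum_{A\in f(\Gamma)}v(A)\le\sum_{B\in f(\Delta)}v(B)$ (equivalently the disjunction over $f$ of the interpretations of $f(\Gamma)\vdash f(\Delta)$ is valid in abelian logic). Calculus $\mathbf{GA_l}$ (premise(s) / conclusion): $(t,l)$ $\Gamma\vdash\Delta/\Gamma,x:t\vdash\Delta$; $(t,r)$ $\Gamma\vdash\Delta/\Gamma\vdash x:t,\Delta$; $(\lnot,l)$ $\Gamma\vdash x:A,\Delta/\Gamma,x:\lnot A\vdash\Delta$; $(\lnot,r)$ $\Gamma,x:A\vdash\Delta/\Gamma\vdash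 x:\lnot A,\Delta$; $(+,l)$ $\Gamma,x:A,x:B\vdash\Delta/\Gamma,x:A+B\vdash\Delta$; $(+,r)$ $\Gamma\vdash\Delta,x:A,x:B/\Gamma\vdash\Delta,x:A+B$; $(\to,l)$ $\Gamma,x:B\vdash\Delta,x:A/\Gamma,x:A\to B\vdash\Delta$; $(\to,r)$ $\Gamma,x:A\vdash\Delta,x:B/\Gamma\vdash\Delta,x:A\to B$; $(\Rightarrow,l)$ $\Gamma,xy:B\vdash\Delta,xy:A/\Gamma,x:A\Rightarrow B\vdash\Delta$ where $y$ is an atomic label not occurring in the conclusion; $(\Rightarrow,r)$ two premises $\Gamma,x:A\vdash\Delta,x:B$ and $\Gamma\vdash\Delta$, conclusion $\Gamma\vdash\Delta,x:A\Rightarrow B$; (success) axiom $\Gamma\vdash\Delta$ whenever all formulas in $\Gamma,\Delta$ are propositional variables and there exist labelling functions $f_1,\ldots,f_n$ ($n\ge1$) with $\biguplus_{i=1}^n f_i(\Gamma)=\biguplus_{i=1}^n f_i(\Delta)$ (multiset union). -}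

module Defs where

open import Data.Nat using (ℕ)
open import Data.Bool using (Bool; true; false; _∧_)
open import Data.Rational using (ℚ; 0ℚ; _+_; _-_; -_; _⊓_; _≤_)
open import Data.List using (List; []; _∷_; _++_; map; concatMap; foldr)
open import Data.List.Relation.Binary.Permutation.Propositional using (_↭_)
open import Data.List.Relation.Unary.All using (All)
open import Data.Product using (Σ; ∃; _×_; _,_)
open import Relation.Binary.PropositionalEquality using (_≡_)
open import Relation.Nullary using (¬_)

infixr 5 _`→_ _`⇒_
infixl 6 _`+_

data Formula : Set where
  var  : ℕ → Formula
  `t   : Formula
  _`+_ : Formula → Formula → Formula
  `¬   : Formula → Formula
  _`→_ : Formula → Formula → Formula
  _`⇒_ : Formula → Formula → Formula

data IsVar : Formula → Set where
  isVar : ∀ n → IsVar (var n)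

Valuation : Set
Valuation = ℕ → ℚ

⟦_⟧ : Formula → Valuation → ℚ
⟦ var n ⟧   v = v n
⟦ `t ⟧      v = 0ℚ
⟦ A `+ B ⟧  v = ⟦ A ⟧ v + ⟦ B ⟧ v
⟦ `¬ A ⟧    v = - ⟦ A ⟧ v
⟦ A `→ B ⟧  v = ⟦ B ⟧ v - ⟦ A ⟧ v
⟦ A `⇒ B ⟧  v = 0ℚ ⊓ (⟦ B ⟧ v - ⟦ A ⟧ v)

data Label : Set where
  one  : Label
  atom : ℕ → Label
  _·_  : Label → Label → Label

data OccursIn (y : ℕ) : Label → Set where
  here  : OccursIn y (atom y)
  left  : ∀ {x z} → OccursIn y x → OccursIn y (x · z)
  right : ∀ {x z} → OccursIn y z → OccursIn y (x · z)

record LFormula : Set where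
  constructor _∶_
  field
    label   : Label
    formula : Formula

infix 4 _∶_

-- multisets of labelled formulas are represented by lists, taken up to
-- permutation (see the exchange rule below)
Ctx : Set
Ctx = List LFormula

OccursInCtx : ℕ → Ctx → Set
OccursInCtx y Γ = Data.List.Relation.Unary.Any.Any
  (λ lf → OccursIn y (LFormula.label lf)) Γ
  where import Data.List.Relation.Unary.Any

record LabellingFunction : Set where
  field
    fn     : Label → Bool
    f-one  : fn one ≡ true
    f-cat  : ∀ x y → fn (x · y) ≡ fn x ∧ fn y

open LabellingFunction public

apply : LabellingFunction → Ctx → List Formula
apply f []             = []
apply f ((x ∶ A) ∷ Γ) with fn f x
... | true  = A ∷ apply f Γ
... | false = apply f Γ

sumV : Valuation → List Formula → ℚ
sumV v As = foldr _+_ 0ℚ (map (λ A → ⟦ A ⟧ v) As)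

record Sequent : Set where
  constructor _⊢_
  field
    ante : Ctx
    succ : Ctx

infix 3 _⊢_

⊨A : Sequent → Set
⊨A (Γ ⊢ Δ) = (v : Valuation) →
  Σ LabellingFunction λ f → sumV v (apply f Γ) ≤ sumV v (apply f Δ)

-- ⊎_{i=1}^n f_i(Γ), n ≥ 1, for the nonempty list f₀ ∷ fs
applyAll : LabellingFunction → List LabellingFunction → Ctx → List Formula
applyAll f₀ fs Γ = concatMap (λ f → apply f Γ) (f₀ ∷ fs)

AllVars : Ctx → Set
AllVars Γ = All (λ lf → IsVar (LFormula.formula lf)) Γ

data GAl : Sequent → Set where
  exch : ∀ {Γ Γ' Δ Δ'} → Γ ↭ Γ' → Δ ↭ Δ' → GAl (Γ ⊢ Δ) → GAl (Γ' ⊢ Δ')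
  t-l  : ∀ {Γ Δ x} → GAl (Γ ⊢ Δ) → GAl ((x ∶ `t) ∷ Γ ⊢ Δ)
  t-r  : ∀ {Γ Δ x} → GAl (Γ ⊢ Δ) → GAl (Γ ⊢ (x ∶ `t) ∷ Δ)
  ¬-l  : ∀ {Γ Δ x A} → GAl (Γ ⊢ (x ∶ A) ∷ Δ) → GAl ((x ∶ `¬ A) ∷ Γ ⊢ Δ)
  ¬-r  : ∀ {Γ Δ x A} → GAl ((x ∶ A) ∷ Γ ⊢ Δ) → GAl (Γ ⊢ (x ∶ `¬ A) ∷ Δ)
  +-l  : ∀ {Γ Δ x A B} → GAl ((x ∶ A) ∷ (x ∶ B) ∷ Γ ⊢ Δ)
       → GAl ((x ∶ A `+ B) ∷ Γ ⊢ Δ)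
  +-r  : ∀ {Γ Δ x A B} → GAl (Γ ⊢ (x ∶ A) ∷ (x ∶ B) ∷ Δ)
       → GAl (Γ ⊢ (x ∶ A `+ B) ∷ Δ)
  →-l  : ∀ {Γ Δ x A B} → GAl ((x ∶ B) ∷ Γ ⊢ (x ∶ A) ∷ Δ)
       → GAl ((x ∶ A `→ B) ∷ Γ ⊢ Δ)
  →-r  : ∀ {Γ Δ x A B} → GAl ((x ∶ A) ∷ Γ ⊢ (x ∶ B) ∷ Δ)
       → GAl (Γ ⊢ (x ∶ A `→ B) ∷ Δ)
  ⇒-l  : ∀ {Γ Δ x A B} (y : ℕ)
       → ¬ OccursInCtx y ((x ∶ A `⇒ B) ∷ Γ)
       → ¬ OccursInCtx y Δ
       → GAl (((x · atom y) ∶ B) ∷ Γ ⊢ ((x · atom y) ∶ A) ∷ Δ)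
       → GAl ((x ∶ A `⇒ B) ∷ Γ ⊢ Δ)
  ⇒-r  : ∀ {Γ Δ x A B} → GAl ((x ∶ A) ∷ Γ ⊢ (x ∶ B) ∷ Δ) → GAl (Γ ⊢ Δ)
       → GAl (Γ ⊢ (x ∶ A `⇒ B) ∷ Δ)
  success : ∀ {Γ Δ} → AllVars Γ → AllVars Δ
          → (f₀ : LabellingFunction) (fs : List LabellingFunction)
          → applyAll f₀ fs Γ ↭ applyAll f₀ fs Δ
          → GAl (Γ ⊢ Δ)

-- Read f(x) ∈ {0,1} as the coefficient of x:A.  Then ⊨A Γ ⊢ Δ says that for every
-- valuation some labelling function makes the weighted balance
--   Σ_{x:B ∈ Δ} f(x) v(B) − Σ_{x:A ∈ Γ} f(x) v(A)
-- non-negative.  Since v is additive, the rules for t, ¬, + and → leave this balance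
-- unchanged, (⇒,r) leaves it unchanged for the premise selected by the sign of
-- v(B) − v(A), and (⇒,l) can only increase it, because f(xy) = f(x)f(y) ≤ f(x) and
-- min(0, c) ≤ c, 0.  For an instance of the success axiom the balances of f₁,…,fₙ sum
-- to zero, so one of them is non-negative.
module Submission where

open import Defs
open import Algebra.Bundles using (CommutativeMonoid)
open import Data.Bool using (Bool; true; false; _∧_)
open import Data.List using (List; []; _∷_; _++_; map; concatMap; foldr)
open import Data.List.Relation.Binary.Permutation.Propositional using (_↭_; ↭⇒↭ₛ)
open import Data.List.Relation.Binary.Permutation.Propositional.Properties using (map⁺)
open import Data.List.Relation.Binary.Permutation.Setoid.Properties using (foldr-commMonoid)
open import Data.Product using (Σ; _,_)
open import Data.Rational using (ℚ; 0ℚ; 1ℚ; _+_; _-_; -_; _*_; _⊓_; _≤_)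
open import Data.Rational.Properties
open import Data.Sum using (inj₁; inj₂)
open import Level using (0ℓ)
open import Relation.Binary.PropositionalEquality using (_≡_; refl; sym; trans; cong; cong₂; subst₂; module ≡-Reasoning)
open import Relation.Nullary using (yes; no)
open import Relation.Nullary.Decidable using (dec⇒maybe)
open import Tactic.RingSolver using (solve-∀)
import Tactic.RingSolver.Core.AlmostCommutativeRing as ACR

ℚ-ring : ACR.AlmostCommutativeRing 0ℓ 0ℓ
ℚ-ring = ACR.fromCommutativeRing +-*-commutativeRing (λ q → dec⇒maybe (0ℚ ≟ q))

0≤q-p⇒p≤q : ∀ {p q} → 0ℚ ≤ q - p → p ≤ q
0≤q-p⇒p≤q {p} {q} 0≤q-p = subst₂ _≤_ (+-identityˡ p) (cancel q p) (+-monoˡ-≤ p 0≤q-p)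
  where
  cancel : ∀ q p → q - p + p ≡ q
  cancel = solve-∀ ℚ-ring

p≤q⇒0≤q-p : ∀ {p q} → p ≤ q → 0ℚ ≤ q - p
p≤q⇒0≤q-p {p} p≤q = subst₂ _≤_ (+-inverseʳ p) refl (+-monoˡ-≤ (- p) p≤q)

private
  variable
    A : Set

sumMap : (A → ℚ) → List A → ℚ
sumMap g xs = foldr _+_ 0ℚ (map g xs)

sumMap-++ : ∀ (g : A → ℚ) xs ys → sumMap g (xs ++ ys) ≡ sumMap g xs + sumMap g ys
sumMap-++ g []       ys = sym (+-identityˡ _)
sumMap-++ g (x ∷ xs) ys = begin
  g x + sumMap g (xs ++ ys)            ≡⟨ cong (g x +_) (sumMap-++ g xs ys) ⟩
  g x + (sumMap g xs + sumMap g ys)    ≡⟨ +-assoc (g x) _ _ ⟨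
  g x + sumMap g xs + sumMap g ys      ∎
  where open ≡-Reasoning

sumMap-↭ : ∀ (g : A → ℚ) {xs ys} → xs ↭ ys → sumMap g xs ≡ sumMap g ys
sumMap-↭ g xs↭ys =
  foldr-commMonoid ℚ+.setoid ℚ+.isCommutativeMonoid (↭⇒↭ₛ (map⁺ g xs↭ys))
  where module ℚ+ = CommutativeMonoid +-0-commutativeMonoid

sumMap-≤⇒∃≤ : ∀ (g h : A → ℚ) x xs → sumMap g (x ∷ xs) ≤ sumMap h (x ∷ xs) → Σ A λ y → g y ≤ h y
sumMap-≤⇒∃≤ g h x []       Σg≤Σh = x , subst₂ _≤_ (+-identityʳ (g x)) (+-identityʳ (h x)) Σg≤Σh
sumMap-≤⇒∃≤ g h x (y ∷ ys) Σg≤Σh with g x ≤? h x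
... | yes gx≤hx = x , gx≤hx
... | no  gx≰hx = sumMap-≤⇒∃≤ g h y ys (0≤q-p⇒p≤q 0≤Σh-Σg)
  where
  regroup : ∀ a b c d → (c + d) - (a + b) + (a - c) ≡ d - b
  regroup = solve-∀ ℚ-ring

  0≤Σh-Σg : 0ℚ ≤ sumMap h (y ∷ ys) - sumMap g (y ∷ ys)
  0≤Σh-Σg = subst₂ _≤_ (+-identityˡ 0ℚ) (regroup (g x) (sumMap g (y ∷ ys)) (h x) (sumMap h (y ∷ ys)))
    (+-mono-≤ (p≤q⇒0≤q-p Σg≤Σh) (p≤q⇒0≤q-p (<⇒≤ (≰⇒> gx≰hx))))

indicator : Bool → ℚ
indicator true  = 1ℚ
indicator false = 0ℚ

module _ (v : Valuation) (f : LabellingFunction) where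

  -- Written as a product, so that the rule identities below are ring identities.
  weight : LFormula → ℚ
  weight (x ∶ A) = indicator (fn f x) * ⟦ A ⟧ v

  mass : Ctx → ℚ
  mass = sumMap weight

  balance : Sequent → ℚ
  balance (Γ ⊢ Δ) = mass Δ - mass Γ

  sumV-apply : ∀ Γ → sumV v (apply f Γ) ≡ mass Γ
  sumV-apply []            = refl
  sumV-apply ((x ∶ A) ∷ Γ) with fn f x
  ... | true  = cong₂ _+_ (sym (*-identityˡ (⟦ A ⟧ v))) (sumV-apply Γ)
  ... | false = begin
    sumV v (apply f Γ)         ≡⟨ sumV-apply Γ ⟩
    mass Γ                     ≡⟨ +-identityˡ (mass Γ) ⟨
    0ℚ + mass Γ                ≡⟨ cong (_+ mass Γ) (*-zeroˡ (⟦ A ⟧ v)) ⟨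
    0ℚ * ⟦ A ⟧ v + mass Γ      ∎
    where open ≡-Reasoning

indicator-⊓ : ∀ p q c → indicator p * (0ℚ ⊓ c) ≤ indicator (p ∧ q) * c
indicator-⊓ false q     c = ≤-reflexive (trans (*-zeroˡ (0ℚ ⊓ c)) (sym (*-zeroˡ c)))
indicator-⊓ true  true  c = subst₂ _≤_ (sym (*-identityˡ (0ℚ ⊓ c))) (sym (*-identityˡ c)) (p⊓q≤q 0ℚ c)
indicator-⊓ true  false c = subst₂ _≤_ (sym (*-identityˡ (0ℚ ⊓ c))) (sym (*-zeroˡ c)) (p⊓q≤p 0ℚ c)

weight-⇒≤weight-→ : ∀ v f {x A B} y → weight v f (x ∶ A `⇒ B) ≤ weight v f ((x · atom y) ∶ A `→ B)
weight-⇒≤weight-→ v f {x} {A} {B} y rewrite f-cat f x (atom y) =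
  indicator-⊓ (fn f x) (fn f (atom y)) (⟦ B ⟧ v - ⟦ A ⟧ v)

sumV-applyAll : ∀ v Γ fs → sumV v (concatMap (λ f → apply f Γ) fs) ≡ sumMap (λ f → mass v f Γ) fs
sumV-applyAll v Γ []       = refl
sumV-applyAll v Γ (f ∷ fs) =
  trans (sumMap-++ (λ A → ⟦ A ⟧ v) (apply f Γ) (concatMap (λ f → apply f Γ) fs))
        (cong₂ _+_ (sumV-apply v f Γ) (sumV-applyAll v Γ fs))

record Balanced (v : Valuation) (S : Sequent) : Set where
  constructor _,_
  field
    labelling : LabellingFunction
    nonneg    : 0ℚ ≤ balance v labelling S

module _ {v : Valuation} where

  preserve : ∀ {S S′} → (∀ f → balance v f S ≤ balance v f S′) → Balanced v S → Balanced v S′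
  preserve step (f , 0≤balance) = f , ≤-trans 0≤balance (step f)

  preserve-≡ : ∀ {S S′} → (∀ f → balance v f S ≡ balance v f S′) → Balanced v S → Balanced v S′
  preserve-≡ eq = preserve (λ f → ≤-reflexive (eq f))

  exch-balanced : ∀ {Γ Γ′ Δ Δ′} → Γ ↭ Γ′ → Δ ↭ Δ′ → Balanced v (Γ ⊢ Δ) → Balanced v (Γ′ ⊢ Δ′)
  exch-balanced Γ↭Γ′ Δ↭Δ′ = preserve-≡ λ f →
    cong₂ _-_ (sumMap-↭ (weight v f) Δ↭Δ′) (sumMap-↭ (weight v f) Γ↭Γ′)

  lighten-antecedent : ∀ {Γ Δ C C′} → (∀ f → weight v f C′ ≤ weight v f C) →
                       Balanced v (C ∷ Γ ⊢ Δ) → Balanced v (C′ ∷ Γ ⊢ Δ)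
  lighten-antecedent {Γ} {Δ} lighter = preserve λ f →
    +-monoʳ-≤ (mass v f Δ) (neg-antimono-≤ (+-monoˡ-≤ (mass v f Γ) (lighter f)))

  reweigh-succedent : ∀ {Γ Δ C C′} → (∀ f → weight v f C ≡ weight v f C′) →
                      Balanced v (Γ ⊢ C ∷ Δ) → Balanced v (Γ ⊢ C′ ∷ Δ)
  reweigh-succedent {Γ} {Δ} same = preserve-≡ λ f →
    cong (λ w → (w + mass v f Δ) - mass v f Γ) (same f)

  t-l-balanced : ∀ {Γ Δ x} → Balanced v (Γ ⊢ Δ) → Balanced v ((x ∶ `t) ∷ Γ ⊢ Δ)
  t-l-balanced {Γ} {Δ} {x} = preserve-≡ λ f →
    identity (indicator (fn f x)) (mass v f Γ) (mass v f Δ)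
    where
    identity : ∀ i g d → d - g ≡ d - (i * 0ℚ + g)
    identity = solve-∀ ℚ-ring

  t-r-balanced : ∀ {Γ Δ x} → Balanced v (Γ ⊢ Δ) → Balanced v (Γ ⊢ (x ∶ `t) ∷ Δ)
  t-r-balanced {Γ} {Δ} {x} = preserve-≡ λ f →
    identity (indicator (fn f x)) (mass v f Γ) (mass v f Δ)
    where
    identity : ∀ i g d → d - g ≡ (i * 0ℚ + d) - g
    identity = solve-∀ ℚ-ring

  ¬-l-balanced : ∀ {Γ Δ x A} → Balanced v (Γ ⊢ (x ∶ A) ∷ Δ) → Balanced v ((x ∶ `¬ A) ∷ Γ ⊢ Δ)
  ¬-l-balanced {Γ} {Δ} {x} {A} = preserve-≡ λ f →
    identity (indicator (fn f x)) (⟦ A ⟧ v) (mass v f Γ) (mass v f Δ)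
    where
    identity : ∀ i a g d → (i * a + d) - g ≡ d - (i * (- a) + g)
    identity = solve-∀ ℚ-ring

  ¬-r-balanced : ∀ {Γ Δ x A} → Balanced v ((x ∶ A) ∷ Γ ⊢ Δ) → Balanced v (Γ ⊢ (x ∶ `¬ A) ∷ Δ)
  ¬-r-balanced {Γ} {Δ} {x} {A} = preserve-≡ λ f →
    identity (indicator (fn f x)) (⟦ A ⟧ v) (mass v f Γ) (mass v f Δ)
    where
    identity : ∀ i a g d → d - (i * a + g) ≡ (i * (- a) + d) - g
    identity = solve-∀ ℚ-ring

  +-l-balanced : ∀ {Γ Δ x A B} →
                 Balanced v ((x ∶ A) ∷ (x ∶ B) ∷ Γ ⊢ Δ) → Balanced v ((x ∶ A `+ B) ∷ Γ ⊢ Δ)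
  +-l-balanced {Γ} {Δ} {x} {A} {B} = preserve-≡ λ f →
    identity (indicator (fn f x)) (⟦ A ⟧ v) (⟦ B ⟧ v) (mass v f Γ) (mass v f Δ)
    where
    identity : ∀ i a b g d → d - (i * a + (i * b + g)) ≡ d - (i * (a + b) + g)
    identity = solve-∀ ℚ-ring

  +-r-balanced : ∀ {Γ Δ x A B} →
                 Balanced v (Γ ⊢ (x ∶ A) ∷ (x ∶ B) ∷ Δ) → Balanced v (Γ ⊢ (x ∶ A `+ B) ∷ Δ)
  +-r-balanced {Γ} {Δ} {x} {A} {B} = preserve-≡ λ f →
    identity (indicator (fn f x)) (⟦ A ⟧ v) (⟦ B ⟧ v) (mass v f Γ) (mass v f Δ)
    where
    identity : ∀ i a b g d → (i * a + (i * b + d)) - g ≡ (i * (a + b) + d) - g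
    identity = solve-∀ ℚ-ring

  →-l-balanced : ∀ {Γ Δ x A B} →
                 Balanced v ((x ∶ B) ∷ Γ ⊢ (x ∶ A) ∷ Δ) → Balanced v ((x ∶ A `→ B) ∷ Γ ⊢ Δ)
  →-l-balanced {Γ} {Δ} {x} {A} {B} = preserve-≡ λ f →
    identity (indicator (fn f x)) (⟦ A ⟧ v) (⟦ B ⟧ v) (mass v f Γ) (mass v f Δ)
    where
    identity : ∀ i a b g d → (i * a + d) - (i * b + g) ≡ d - (i * (b - a) + g)
    identity = solve-∀ ℚ-ring

  →-r-balanced : ∀ {Γ Δ x A B} →
                 Balanced v ((x ∶ A) ∷ Γ ⊢ (x ∶ B) ∷ Δ) → Balanced v (Γ ⊢ (x ∶ A `→ B) ∷ Δ)
  →-r-balanced {Γ} {Δ} {x} {A} {B} = preserve-≡ λ f →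
    identity (indicator (fn f x)) (⟦ A ⟧ v) (⟦ B ⟧ v) (mass v f Γ) (mass v f Δ)
    where
    identity : ∀ i a b g d → (i * b + d) - (i * a + g) ≡ (i * (b - a) + d) - g
    identity = solve-∀ ℚ-ring

  ⇒-l-balanced : ∀ {Γ Δ x A B} y →
                 Balanced v (((x · atom y) ∶ B) ∷ Γ ⊢ ((x · atom y) ∶ A) ∷ Δ) →
                 Balanced v ((x ∶ A `⇒ B) ∷ Γ ⊢ Δ)
  ⇒-l-balanced {x = x} {A} {B} y premise =
    lighten-antecedent (λ f → weight-⇒≤weight-→ v f {x} {A} {B} y) (→-l-balanced premise)

  ⇒-r-balanced : ∀ {Γ Δ x A B} → Balanced v ((x ∶ A) ∷ Γ ⊢ (x ∶ B) ∷ Δ) → Balanced v (Γ ⊢ Δ) →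
                 Balanced v (Γ ⊢ (x ∶ A `⇒ B) ∷ Δ)
  ⇒-r-balanced {x = x} {A} {B} premise₁ premise₂ with ≤-total 0ℚ (⟦ B ⟧ v - ⟦ A ⟧ v)
  ... | inj₁ 0≤c = reweigh-succedent (λ f → cong (indicator (fn f x) *_) (sym (p≤q⇒p⊓q≡p 0≤c)))
                                     (t-r-balanced premise₂)
  ... | inj₂ c≤0 = reweigh-succedent (λ f → cong (indicator (fn f x) *_) (sym (p≥q⇒p⊓q≡q c≤0)))
                                     (→-r-balanced premise₁)

  success-balanced : ∀ {Γ Δ} f₀ fs → applyAll f₀ fs Γ ↭ applyAll f₀ fs Δ → Balanced v (Γ ⊢ Δ)
  success-balanced {Γ} {Δ} f₀ fs Γs↭Δs =
    let f , massΓ≤massΔ = sumMap-≤⇒∃≤ (λ f → mass v f Γ) (λ f → mass v f Δ) f₀ fs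
                                       (≤-reflexive totals-agree)
    in  f , p≤q⇒0≤q-p massΓ≤massΔ
    where
    totals-agree : sumMap (λ f → mass v f Γ) (f₀ ∷ fs) ≡ sumMap (λ f → mass v f Δ) (f₀ ∷ fs)
    totals-agree = begin
      sumMap (λ f → mass v f Γ) (f₀ ∷ fs)   ≡⟨ sumV-applyAll v Γ (f₀ ∷ fs) ⟨
      sumV v (applyAll f₀ fs Γ)             ≡⟨ sumMap-↭ (λ A → ⟦ A ⟧ v) Γs↭Δs ⟩
      sumV v (applyAll f₀ fs Δ)             ≡⟨ sumV-applyAll v Δ (f₀ ∷ fs) ⟩
      sumMap (λ f → mass v f Δ) (f₀ ∷ fs)   ∎
      where open ≡-Reasoning

sound : ∀ {S} → GAl S → ∀ v → Balanced v S
sound (exch Γ↭Γ′ Δ↭Δ′ d)        v = exch-balanced Γ↭Γ′ Δ↭Δ′ (sound d v)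
sound (t-l d)                   v = t-l-balanced (sound d v)
sound (t-r d)                   v = t-r-balanced (sound d v)
sound (¬-l d)                   v = ¬-l-balanced (sound d v)
sound (¬-r d)                   v = ¬-r-balanced (sound d v)
sound (+-l d)                   v = +-l-balanced (sound d v)
sound (+-r d)                   v = +-r-balanced (sound d v)
sound (→-l d)                   v = →-l-balanced (sound d v)
sound (→-r d)                   v = →-r-balanced (sound d v)
sound (⇒-l y _ _ d)             v = ⇒-l-balanced y (sound d v)
sound (⇒-r d₁ d₂)               v = ⇒-r-balanced (sound d₁ v) (sound d₂ v)
sound (success _ _ f₀ fs Γs↭Δs) v = success-balanced f₀ fs Γs↭Δs

mainTheorem13 : (S : Sequent) → GAl S → ⊨A S
mainTheorem13 (Γ ⊢ Δ) d v with sound d v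
... | f , 0≤balance = f , subst₂ _≤_ (sym (sumV-apply v f Γ)) (sym (sumV-apply v f Δ)) (0≤q-p⇒p≤q 0≤balance)
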